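{- If $2$ divides $n$, $3$ divides $n$, $n$ is a Zumkeller number, and $\sigma(n)<\frac{10n}{3}$, then $n$ is a half-Zumkeller number.
   Context: $\sigma(n)$ denotes the sum of all positive divisors of $n$. A positive integer $n$ is a Zumkeller number if the set of all positive divisors of $n$ can be partitioned into two disjoint parts whose sums are equal. A positive integer $n$ is a half-Zumkeller number if the set of all positive divisors of $n$ other than $n$ itself can be partitioned into two disjoint parts whose sums are equal. -}

module Defs where

open import Data.Nat using (ℕ; zero; suc; _+_; _*_; _<_)
open import Data.Nat.Divisibility using (_∣_; _∣?_)
open import Data.List using (List; filter; upTo; map; _++_)
open import Data.Nat.ListAction using (sum)
open import Data.List.Relation.Binary.Permutation.Propositional using (_↭_)
open import Data.Product using (Σ; _×_; ∃₂)
open import Relation.Binary.PropositionalEquality using (_≡_)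
open import Relation.Nullary using (¬_)
open import Relation.Nullary.Decidable using (¬?)
open import Data.Nat.Properties using (_≟_)

oneTo : ℕ → List ℕ
oneTo n = map suc (upTo n)

-- all positive divisors of n, in increasing order (for n ≥ 1)
divisors : ℕ → List ℕ
divisors n = filter (λ d → d ∣? n) (oneTo n)

properDivisors : ℕ → List ℕ
properDivisors n = filter (λ d → ¬? (d ≟ n)) (divisors n)

σ : ℕ → ℕ
σ n = sum (divisors n)

-- a (duplicate-free) list can be partitioned into two disjoint parts with equal sums
EqualSumPartition : List ℕ → Set
EqualSumPartition xs = ∃₂ λ (A B : List ℕ) → ((A ++ B) ↭ xs) × (sum A ≡ sum B)

Zumkeller : ℕ → Set
Zumkeller n = EqualSumPartition (divisors n)

HalfZumkeller : ℕ → Set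
HalfZumkeller n = EqualSumPartition (properDivisors n)

module Submission where

-- Let n be Zumkeller with 6 ∣ n, say n = 6k, and σ(n) < 10n/3, and let
-- A ⊎ B be an equal-sum partition of the divisors, with n ∈ A.  Since
-- sum A = σ(n)/2 < 10k, the argument is an exchange: if the other part B
-- contains divisors Y with sum Y = n/2 = 3k, then
--     (A ∖ {n}) ∪ Y   and   B ∖ Y
-- have equal sums and partition the proper divisors (lemma exchange).
--   * If 3k ∈ B, take Y = {3k}.
--   * If 3k ∈ A, then A = {6k, 3k} ∪ A₁ with sum A₁ < k, so the divisors
--     2k and k (both ≥ k, different from 6k and 3k) cannot lie in A;
--     hence they lie in B and we take Y = {2k, k}.

open import Defs
open import Data.Nat using (ℕ; zero; suc; _+_; _*_; _≤_; _<_; NonZero; ≢-nonZero⁻¹; >-nonZero; z≤n; s≤s)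
open import Data.Nat.Properties
  using (_≟_; suc-injective; ≤-trans; ≤-<-trans; <-≤-trans; <-irrefl; <⇒≢; m≤m+n; m≤n+m;
         m≤n*m; +-assoc; *-comm; +-cancelˡ-≡; +-cancelˡ-<; *-cancelˡ-<; *-cancelʳ-≡;
         m*n≢0; m*n≢0⇒n≢0)
open import Data.Nat.Divisibility using (_∣_; _∣?_; divides; ∣-refl; ∣⇒≤; 0∣⇒≡0; *-monoˡ-∣)
open import Data.Nat.LCM using (lcm-least)
open import Data.Nat.ListAction using (sum)
open import Data.Nat.ListAction.Properties using (sum-↭; sum-++)
open import Data.Nat.Tactic.RingSolver using (solve-∀)
open import Data.List using (List; []; _∷_; _++_; [_])
open import Data.List.Properties using (filter-all; filter-reject)
open import Data.List.Membership.Propositional using (_∈_)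
open import Data.List.Membership.Propositional.Properties
  using (∈-∃++; ∈-++⁻; ∈-filter⁺; ∈-map⁺; ∈-upTo⁺)
open import Data.List.Relation.Unary.Any using (here; there)
open import Data.List.Relation.Unary.All as All using (All)
open import Data.List.Relation.Unary.AllPairs using (_∷_)
open import Data.List.Relation.Unary.Unique.Propositional using (Unique)
import Data.List.Relation.Unary.Unique.Propositional.Properties as Unique
open import Data.List.Relation.Binary.Permutation.Propositional
  using (_↭_; ↭-sym; ↭-trans; ↭-reflexive; prep; ↭⇒↭ₛ)
open import Data.List.Relation.Binary.Permutation.Propositional.Properties
  using (∈-resp-↭; shift; shifts; ++⁺; ++-assoc; ++-comm; filter-↭)
import Data.List.Relation.Binary.Permutation.Setoid.Properties as PermSetoid
open import Data.Product using (∃; _,_)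
open import Data.Sum using (_⊎_; inj₁; inj₂)
open import Relation.Nullary using (¬_; contradiction)
open import Relation.Nullary.Decidable using (¬?)
open import Relation.Binary.PropositionalEquality
  using (_≡_; _≢_; refl; sym; trans; cong; cong₂; subst; subst₂; setoid; module ≡-Reasoning)

open PermSetoid (setoid ℕ) using (Unique-resp-↭)

extract : ∀ {x : ℕ} {xs : List ℕ} → x ∈ xs → ∃ λ ys → xs ↭ x ∷ ys
extract {x} x∈xs with ys , zs , refl ← ∈-∃++ x∈xs = ys ++ zs , shift x ys zs

∈⇒≤sum : ∀ {x : ℕ} {xs : List ℕ} → x ∈ xs → x ≤ sum xs
∈⇒≤sum {xs = y ∷ ys} (here refl)  = m≤m+n y (sum ys)
∈⇒≤sum {xs = y ∷ ys} (there x∈ys) = ≤-trans (∈⇒≤sum x∈ys) (m≤n+m (sum ys) y)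

∈-parts : ∀ {x : ℕ} {xs} A B → A ++ B ↭ xs → x ∈ xs → x ∈ A ⊎ x ∈ B
∈-parts A B p x∈xs = ∈-++⁻ A (∈-resp-↭ (↭-sym p) x∈xs)

divisors-unique : ∀ n → Unique (divisors n)
divisors-unique n = Unique.filter⁺ (_∣? n) (Unique.map⁺ suc-injective (Unique.upTo⁺ n))

∈-divisors : ∀ {d n} .{{_ : NonZero n}} → d ∣ n → d ∈ divisors n
∈-divisors {zero} {n} 0∣n = contradiction (0∣⇒≡0 0∣n) (≢-nonZero⁻¹ n)
∈-divisors {suc d} {n} d∣n =
  ∈-filter⁺ (_∣? n) (∈-map⁺ suc (∈-upTo⁺ (∣⇒≤ d∣n))) d∣n

properDivisors-↭ : ∀ {n R} → divisors n ↭ n ∷ R → properDivisors n ↭ R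
properDivisors-↭ {n} {R} p = ↭-trans (filter-↭ ≢n? p)
  (↭-reflexive (trans (filter-reject ≢n? (λ n≢n → n≢n refl)) (filter-all ≢n? R≢n)))
  where
  ≢n? = λ d → ¬? (d ≟ n)
  R≢n : All (λ d → ¬ d ≡ n) R
  R≢n with n≢R ∷ _ ← Unique-resp-↭ (↭⇒↭ₛ p) (divisors-unique n) =
    All.map (λ n≢d d≡n → n≢d (sym d≡n)) n≢R

σ≡double : ∀ {n} A B → A ++ B ↭ divisors n → sum A ≡ sum B → σ n ≡ sum A + sum A
σ≡double {n} A B p eq = begin
  sum (divisors n) ≡⟨ sum-↭ (↭-sym p) ⟩
  sum (A ++ B)     ≡⟨ sum-++ A B ⟩
  sum A + sum B    ≡⟨ cong (sum A +_) eq ⟨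
  sum A + sum A    ∎
  where open ≡-Reasoning

exchange : ∀ {n A B A₀ Y B₀} → A ++ B ↭ divisors n → sum A ≡ sum B →
  A ↭ n ∷ A₀ → B ↭ Y ++ B₀ → sum Y + sum Y ≡ n → HalfZumkeller n
exchange {n} {A} {B} {A₀} {Y} {B₀} p eq A↭ B↭ half = Y ++ A₀ , B₀ , parts , sums
  where
  open ≡-Reasoning
  parts : (Y ++ A₀) ++ B₀ ↭ properDivisors n
  parts = ↭-trans (++-assoc Y A₀ B₀) (↭-trans (shifts Y A₀)
            (↭-sym (properDivisors-↭ (↭-trans (↭-sym p) (++⁺ A↭ B↭)))))
  sums : sum (Y ++ A₀) ≡ sum B₀
  sums = +-cancelˡ-≡ (sum Y) _ _ (begin
    sum Y + sum (Y ++ A₀)    ≡⟨ cong (sum Y +_) (sum-++ Y A₀) ⟩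
    sum Y + (sum Y + sum A₀) ≡⟨ +-assoc (sum Y) (sum Y) (sum A₀) ⟨
    sum Y + sum Y + sum A₀   ≡⟨ cong (_+ sum A₀) half ⟩
    n + sum A₀               ≡⟨ sum-↭ A↭ ⟨
    sum A                    ≡⟨ eq ⟩
    sum B                    ≡⟨ sum-↭ B↭ ⟩
    sum (Y ++ B₀)            ≡⟨ sum-++ Y B₀ ⟩
    sum Y + sum B₀           ∎)

-- If a part A = {6k, 3k} ∪ A₁ has 3·(2·sum A) < 10·6k, the rest A₁ sums to less than k.
remainder-bound : ∀ k s → 3 * ((6 * k + (3 * k + s)) + (6 * k + (3 * k + s))) < 10 * (6 * k) → s < k
remainder-bound k s bound = +-cancelˡ-< (9 * k) s k (*-cancelˡ-< 6 (9 * k + s) (9 * k + k)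
  (subst₂ _<_ (lhs k s) (rhs k) bound))
  where
  lhs : ∀ k s → 3 * ((6 * k + (3 * k + s)) + (6 * k + (3 * k + s))) ≡ 6 * (9 * k + s)
  lhs = solve-∀
  rhs : ∀ k → 10 * (6 * k) ≡ 6 * (9 * k + k)
  rhs = solve-∀

module MultipleOfSix (k : ℕ) .{{_ : NonZero k}} (A B : List ℕ)
  (partition : A ++ B ↭ divisors (6 * k)) (equal : sum A ≡ sum B) where

  instance
    6k≢0 : NonZero (6 * k)
    6k≢0 = m*n≢0 6 k

  divisor-in-part : ∀ d → d ∣ 6 → d * k ∈ A ⊎ d * k ∈ B
  divisor-in-part d d∣6 = ∈-parts A B partition (∈-divisors (*-monoˡ-∣ k d∣6))

  multiples-≢ : ∀ {a b} → a ≢ b → a * k ≢ b * k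
  multiples-≢ {a} {b} a≢b ak≡bk = a≢b (*-cancelʳ-≡ a b k ak≡bk)

  -- If A contains 6k and 3k then, as sum A < 10k, every other element of A is below k;
  -- hence the divisors 2k and k are in B.
  small-divisors-in-B : ∀ {A₁} → A ↭ 6 * k ∷ 3 * k ∷ A₁ → 3 * σ (6 * k) < 10 * (6 * k) →
    ∀ d → d ∣ 6 → 0 < d → d < 3 → d * k ∈ B
  small-divisors-in-B {A₁} A↭ bound d d∣6 0<d d<3 with divisor-in-part d d∣6
  ... | inj₂ dk∈B = dk∈B
  ... | inj₁ dk∈A with ∈-resp-↭ A↭ dk∈A
  ...   | here dk≡6k = contradiction dk≡6k (multiples-≢ (<⇒≢ (<-≤-trans d<3 (m≤m+n 3 3))))
  ...   | there (here dk≡3k) = contradiction dk≡3k (multiples-≢ (<⇒≢ d<3))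
  ...   | there (there dk∈A₁) = contradiction k<k (<-irrefl refl)
    where
    instance
      d≢0 : NonZero d
      d≢0 = >-nonZero 0<d
    rest<k : sum A₁ < k
    rest<k = remainder-bound k (sum A₁) (subst (λ s → 3 * s < 10 * (6 * k)) σ≡ bound)
      where
      σ≡ : σ (6 * k) ≡ (6 * k + (3 * k + sum A₁)) + (6 * k + (3 * k + sum A₁))
      σ≡ = trans (σ≡double {6 * k} A B partition equal) (cong₂ _+_ (sum-↭ A↭) (sum-↭ A↭))
    k<k : k < k
    k<k = ≤-<-trans (m≤n*m k d) (≤-<-trans (∈⇒≤sum dk∈A₁) rest<k)

  exchange-3k : ∀ {A₀} → A ↭ 6 * k ∷ A₀ → 3 * k ∈ B → HalfZumkeller (6 * k)
  exchange-3k A↭ 3k∈B with B₀ , B↭ ← extract 3k∈B =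
    exchange {Y = [ 3 * k ]} partition equal A↭ B↭ (half-of-3k k)
    where
    half-of-3k : ∀ k → (3 * k + 0) + (3 * k + 0) ≡ 6 * k
    half-of-3k = solve-∀

  exchange-2k+k : ∀ {A₁} → A ↭ 6 * k ∷ 3 * k ∷ A₁ → 3 * σ (6 * k) < 10 * (6 * k) →
    HalfZumkeller (6 * k)
  exchange-2k+k A↭ bound
    with B₁ , B↭ ← extract (small-divisors-in-B A↭ bound 2 (divides 3 refl) (s≤s z≤n) (s≤s (s≤s (s≤s z≤n))))
    with ∈-resp-↭ B↭ (small-divisors-in-B A↭ bound 1 (divides 6 refl) (s≤s z≤n) (s≤s (s≤s z≤n)))
  ... | here k≡2k = contradiction k≡2k (multiples-≢ {1} {2} λ ())
  ... | there k∈B₁ with B₀ , B₁↭ ← extract k∈B₁ =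
    exchange {Y = 2 * k ∷ 1 * k ∷ []} partition equal A↭ (↭-trans B↭ (prep (2 * k) B₁↭))
      (half-of-2k+k k)
    where
    half-of-2k+k : ∀ k → (2 * k + (1 * k + 0)) + (2 * k + (1 * k + 0)) ≡ 6 * k
    half-of-2k+k = solve-∀

  halfZumkeller : 6 * k ∈ A → 3 * σ (6 * k) < 10 * (6 * k) → HalfZumkeller (6 * k)
  halfZumkeller 6k∈A bound
    with A₀ , A↭ ← extract 6k∈A | divisor-in-part 3 (divides 2 refl)
  ... | inj₂ 3k∈B = exchange-3k A↭ 3k∈B
  ... | inj₁ 3k∈A with ∈-resp-↭ A↭ 3k∈A
  ...   | here 3k≡6k = contradiction 3k≡6k (multiples-≢ {3} {6} λ ())
  ...   | there 3k∈A₀ with A₁ , A₀↭ ← extract 3k∈A₀ =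
    exchange-2k+k (↭-trans A↭ (prep (6 * k) A₀↭)) bound

multiple-of-six : ∀ {n} → 2 ∣ n → 3 ∣ n → ∃ λ k → n ≡ 6 * k
multiple-of-six 2∣n 3∣n with divides k n≡k*6 ← lcm-least 2∣n 3∣n = k , trans n≡k*6 (*-comm k 6)

mainTheorem10 : (n : ℕ) → 0 < n → 2 ∣ n → 3 ∣ n → Zumkeller n → 3 * σ n < 10 * n →
    HalfZumkeller n
mainTheorem10 n 0<n 2∣n 3∣n (A , B , partition , equal) bound
  with k , refl ← multiple-of-six 2∣n 3∣n = by-part-containing-6k
  where
  instance
    k≢0 : NonZero k
    k≢0 = m*n≢0⇒n≢0 6 {{>-nonZero 0<n}}
  by-part-containing-6k : HalfZumkeller (6 * k)
  by-part-containing-6k with MultipleOfSix.divisor-in-part k A B partition equal 6 ∣-refl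
  ... | inj₁ 6k∈A = MultipleOfSix.halfZumkeller k A B partition equal 6k∈A bound
  ... | inj₂ 6k∈B = MultipleOfSix.halfZumkeller k B A
          (↭-trans (++-comm B A) partition) (sym equal) 6k∈B bound
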